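{- Let $(c_n)_{n\ge0}$ be a sequence of real numbers with $c_0=1$, and let $(f_n(y))_{n\ge0}$ be the Appell polynomials defined by $\sum_{n\ge0}f_n(y)\frac{t^n}{n!}=\Bigl(\sum_{n\ge0}c_n\frac{t^n}{n!}\Bigr)e^{yt}$. Let $(a_n)_{n\ge0}$ be a sequence of real numbers, and for $0\le j\le n$ put $M(n,j)=\sum_{l=0}^{j}(-1)^l\binom{j}{l}a_{n-l}$ and $\overline{M}(j)=\sum_{l=0}^{j}(-1)^l\binom{j}{l}a_l$. Then for every $n\ge0$, $$\sum_{k=0}^{n}a_k\binom{n}{k}f_k(y)x^{n-k}=\sum_{j=0}^{n}(-1)^j\binom{n}{j}M(n,j)f_{n-j}(x+y)x^j,$$ $$\sum_{k=0}^{n}a_k\binom{n}{k}f_{n-k}(y)x^{k}=\sum_{j=0}^{n}(-1)^j\binom{n}{j}\overline{M}(j)f_{n-j}(x+y)x^{j}.$$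
   Context: Equivalently $f_n(y)=\sum_{k=0}^n\binom{n}{k}c_ky^{n-k}$. -}

module Defs where

open import Level using (Level)
open import Data.Nat using (ℕ; zero; suc; _∸_)
open import Data.Nat.Combinatorics using (_C_)
open import Algebra.Bundles using (CommutativeRing; Semiring)

module _ {c ℓ : Level} (R : CommutativeRing c ℓ) where
  open CommutativeRing R
  open import Algebra.Definitions.RawSemiring (Semiring.rawSemiring semiring) using (_×_; _^_)

  sumTo : ℕ → (ℕ → Carrier) → Carrier
  sumTo zero    f = f 0
  sumTo (suc n) f = sumTo n f + f (suc n)

  binom : ℕ → ℕ → Carrier → Carrier
  binom n k r = (n C k) × r

  sgn : ℕ → Carrier
  sgn l = (- 1#) ^ l

  appell : (ℕ → Carrier) → ℕ → Carrier → Carrier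
  appell cs n y = sumTo n (λ k → binom n k (cs k * y ^ (n ∸ k)))

  M : (ℕ → Carrier) → ℕ → ℕ → Carrier
  M as n j = sumTo j (λ l → sgn l * binom j l (as (n ∸ l)))

  Mbar : (ℕ → Carrier) → ℕ → Carrier
  Mbar as j = sumTo j (λ l → sgn l * binom j l (as l))

  Identity₁ : (ℕ → Carrier) → (ℕ → Carrier) → ℕ → Carrier → Carrier → Set ℓ
  Identity₁ cs as n x y =
    sumTo n (λ k → as k * binom n k (appell cs k y) * x ^ (n ∸ k))
    ≈ sumTo n (λ j → sgn j * binom n j (M as n j) * appell cs (n ∸ j) (x + y) * x ^ j)

  Identity₂ : (ℕ → Carrier) → (ℕ → Carrier) → ℕ → Carrier → Carrier → Set ℓ
  Identity₂ cs as n x y =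
    sumTo n (λ k → as k * binom n k (appell cs (n ∸ k) y) * x ^ k)
    ≈ sumTo n (λ j → sgn j * binom n j (Mbar as j) * appell cs (n ∸ j) (x + y) * x ^ j)

{-# OPTIONS --safe #-}
module Submission where

open import Defs
open import Level using (Level)
open import Data.Nat using (ℕ; zero; suc; _∸_; _≤_; _<_; z≤n)
open import Data.Nat.Properties using (m≤n⇒m≤1+n; ≤-refl; +-∸-assoc; m+[n∸m]≡n)
open import Data.Nat.Combinatorics using (_C_; k>n⇒nCk≡0; nCk+nC[k+1]≡[n+1]C[k+1])
open import Data.Fin using (toℕ)
open import Data.Product using (_×_; _,_)
open import Function using (_∘_)
import Relation.Binary.PropositionalEquality as ≡
open import Algebra.Bundles using (CommutativeRing; Semiring)

-- Read a sequence u as the exponential generating function Σ u_n tⁿ/n!.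
-- Multiplying such series is binomial convolution ⋆, which is therefore
-- commutative and associative with unit (0ⁿ), and multiplying u_n by rⁿ
-- (substituting rt for t) is a ⋆-homomorphism.  In this language
-- f(y) = c ⋆ (yⁿ), so the binomial theorem (x + y)ⁿ = ((xⁿ) ⋆ (yⁿ))_n gives
-- f(x + y) = (xⁿ) ⋆ f(y); and M̄(a) = ((-1)ⁿ a_n) ⋆ (1) is an involution
-- because ((-1)ⁿ) ⋆ (1) = ((-1 + 1)ⁿ) is the unit.  The right-hand side of
-- the second identity is (((-1)ʲ M̄(j) xʲ) ⋆ f(x + y))_n
-- = (((-1)ʲ M̄(j) xʲ) ⋆ (xʲ) ⋆ f(y))_n = ((a_k xᵏ) ⋆ f(y))_n, its left-hand
-- side.  Since M(n, j) is M̄(j) for the sequence (a_{n-l})_l, the first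
-- identity is the second one for that sequence, after reindexing its
-- left-hand side by k ↦ n - k.

module BinomialConvolution {c ℓ : Level} (R : CommutativeRing c ℓ) where
  open CommutativeRing R
  open import Algebra.Definitions.RawSemiring (Semiring.rawSemiring semiring) using (_^_; sum)
  open import Algebra.Properties.Monoid.Mult +-monoid using (×-congʳ; ×-congˡ; ×-homo-1; ×-homo-+)
  open import Algebra.Properties.Semiring.Mult semiring using (×-comm-*; ×-assoc-*)
  open import Algebra.Properties.CommutativeMonoid.Mult +-commutativeMonoid using (×-distrib-+)
  open import Algebra.Properties.Semiring.Exp semiring using (^-homo-*; ^-congʳ; ^-congˡ)
  open import Algebra.Properties.CommutativeSemiring.Exp commutativeSemiring using (^-distrib-*)
  open import Algebra.Properties.CommutativeSemiring.Binomial commutativeSemiring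
    using () renaming (theorem to binomialTheorem)
  open import Algebra.Properties.Ring ring using (-1*x≈-x; -‿involutive)
  open import Algebra.Properties.CommutativeSemigroup *-commutativeSemigroup
    using (interchange; xy∙z≈xz∙y; x∙yz≈yx∙z)
  open import Algebra.Properties.CommutativeSemigroup +-commutativeSemigroup
    using () renaming (interchange to +-interchange; x∙yz≈y∙xz to x+yz≈y+xz)
  open import Relation.Binary.Reasoning.Setoid setoid

  Seq : Set c
  Seq = ℕ → Carrier

  infix 4 _≋_
  _≋_ : Seq → Seq → Set ℓ
  u ≋ v = ∀ n → u n ≈ v n

  infixl 7 _⊙_ _⋆_

  _⊙_ : Seq → Seq → Seq
  (u ⊙ v) n = u n * v n

  _⋆_ : Seq → Seq → Seq
  (u ⋆ v) n = sumTo R n (λ k → binom R n k (u k * v (n ∸ k)))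

  powers : Carrier → Seq
  powers x n = x ^ n

  shift : Seq → Seq
  shift u = u ∘ suc

  sumTo-cong-≤ : ∀ n {f g : Seq} → (∀ k → k ≤ n → f k ≈ g k) → sumTo R n f ≈ sumTo R n g
  sumTo-cong-≤ zero    f≈g = f≈g 0 z≤n
  sumTo-cong-≤ (suc n) f≈g =
    +-cong (sumTo-cong-≤ n (λ k k≤n → f≈g k (m≤n⇒m≤1+n k≤n))) (f≈g (suc n) ≤-refl)

  sumTo-cong : ∀ n {f g : Seq} → f ≋ g → sumTo R n f ≈ sumTo R n g
  sumTo-cong n f≋g = sumTo-cong-≤ n (λ k _ → f≋g k)

  sumTo-distrib-+ : ∀ n (f g : Seq) → sumTo R n (λ k → f k + g k) ≈ sumTo R n f + sumTo R n g
  sumTo-distrib-+ zero    f g = refl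
  sumTo-distrib-+ (suc n) f g =
    trans (+-congʳ (sumTo-distrib-+ n f g)) (+-interchange _ _ _ _)

  *-distribˡ-sumTo : ∀ n r (f : Seq) → r * sumTo R n f ≈ sumTo R n (λ k → r * f k)
  *-distribˡ-sumTo zero    r f = refl
  *-distribˡ-sumTo (suc n) r f = trans (distribˡ r _ _) (+-congʳ (*-distribˡ-sumTo n r f))

  sumTo-vanishing : ∀ n {f : Seq} → (∀ k → f k ≈ 0#) → sumTo R n f ≈ 0#
  sumTo-vanishing zero    f≈0 = f≈0 0
  sumTo-vanishing (suc n) f≈0 = trans (+-cong (sumTo-vanishing n f≈0) (f≈0 (suc n))) (+-identityˡ 0#)

  sumTo-suc : ∀ n (f : Seq) → sumTo R (suc n) f ≈ f 0 + sumTo R n (shift f)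
  sumTo-suc zero    f = refl
  sumTo-suc (suc n) f = trans (+-congʳ (sumTo-suc n f)) (+-assoc _ _ _)

  sumTo≈sum : ∀ n (f : Seq) → sumTo R n f ≈ sum {suc n} (f ∘ toℕ)
  sumTo≈sum zero    f = sym (+-identityʳ (f 0))
  sumTo≈sum (suc n) f = trans (sumTo-suc n f) (+-congˡ (sumTo≈sum n (shift f)))

  binom-cong : ∀ n k {r s} → r ≈ s → binom R n k r ≈ binom R n k s
  binom-cong n k = ×-congʳ (n C k)

  binom-+ : ∀ n k r s → binom R n k (r + s) ≈ binom R n k r + binom R n k s
  binom-+ n k r s = ×-distrib-+ r s (n C k)

  binom-*ˡ : ∀ n k r s → r * binom R n k s ≈ binom R n k (r * s)
  binom-*ˡ n k = ×-comm-* (n C k)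

  binom-*ʳ : ∀ n k r s → binom R n k r * s ≈ binom R n k (r * s)
  binom-*ʳ n k = ×-assoc-* (n C k)

  binom-float : ∀ n k r s t → r * binom R n k s * t ≈ binom R n k (r * s * t)
  binom-float n k r s t = trans (*-congʳ (binom-*ˡ n k r s)) (binom-*ʳ n k (r * s) t)

  binom-0 : ∀ n r → binom R n 0 r ≈ r
  binom-0 n = ×-homo-1

  binom-beyond : ∀ n k r → n < k → binom R n k r ≈ 0#
  binom-beyond n k r n<k = ×-congˡ (k>n⇒nCk≡0 n<k)

  binom-pascal : ∀ n k r → binom R (suc n) (suc k) r ≈ binom R n k r + binom R n (suc k) r
  binom-pascal n k r =
    trans (×-congˡ (≡.sym (nCk+nC[k+1]≡[n+1]C[k+1] n k))) (×-homo-+ r (n C k) (n C suc k))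

  ⋆-cong : ∀ {u u′ v v′} → u ≋ u′ → v ≋ v′ → u ⋆ v ≋ u′ ⋆ v′
  ⋆-cong u≋u′ v≋v′ n = sumTo-cong n (λ k → binom-cong n k (*-cong (u≋u′ k) (v≋v′ (n ∸ k))))

  ⋆-congˡ : ∀ {u u′} v → u ≋ u′ → u ⋆ v ≋ u′ ⋆ v
  ⋆-congˡ v u≋u′ = ⋆-cong {v = v} u≋u′ (λ _ → refl)

  ⋆-congʳ : ∀ u {v v′} → v ≋ v′ → u ⋆ v ≋ u ⋆ v′
  ⋆-congʳ u = ⋆-cong {u = u} (λ _ → refl)

  ⋆-at-zero : ∀ u v → (u ⋆ v) 0 ≈ u 0 * v 0
  ⋆-at-zero u v = binom-0 0 _

  ⋆-distribʳ-+ : ∀ u u′ v n → ((λ m → u m + u′ m) ⋆ v) n ≈ (u ⋆ v) n + (u′ ⋆ v) n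
  ⋆-distribʳ-+ u u′ v n = trans
    (sumTo-cong n (λ k → trans (binom-cong n k (distribʳ _ _ _)) (binom-+ n k _ _)))
    (sumTo-distrib-+ n _ _)

  ⋆-distribˡ-+ : ∀ u v v′ n → (u ⋆ (λ m → v m + v′ m)) n ≈ (u ⋆ v) n + (u ⋆ v′) n
  ⋆-distribˡ-+ u v v′ n = trans
    (sumTo-cong n (λ k → trans (binom-cong n k (distribˡ _ _ _)) (binom-+ n k _ _)))
    (sumTo-distrib-+ n _ _)

  -- The Leibniz rule: shift is differentiation of exponential generating functions.
  ⋆-suc : ∀ u v n → (u ⋆ v) (suc n) ≈ (shift u ⋆ v) n + (u ⋆ shift v) n
  ⋆-suc u v n = begin
      (u ⋆ v) (suc n)
    ≈⟨ sumTo-suc n _ ⟩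
      head + sumTo R n (λ k → binom R (suc n) (suc k) (term k))
    ≈⟨ +-congˡ (sumTo-cong n (λ k → binom-pascal n k _)) ⟩
      head + sumTo R n (λ k → binom R n k (term k) + binom R n (suc k) (term k))
    ≈⟨ +-congˡ (sumTo-distrib-+ n _ _) ⟩
      head + ((shift u ⋆ v) n + rest)
    ≈⟨ x+yz≈y+xz _ _ _ ⟩
      (shift u ⋆ v) n + (head + rest)
    ≈⟨ +-congˡ (sym (sumTo-suc n (λ k → binom R n k (u k * v (suc n ∸ k))))) ⟩
      (shift u ⋆ v) n + (sumTo R n (λ k → binom R n k (u k * v (suc n ∸ k))) + binom R n (suc n) (term n))
    ≈⟨ +-congˡ (+-cong (sumTo-cong-≤ n (λ k k≤n → binom-cong n k (*-congˡ (reflexive (≡.cong v (+-∸-assoc 1 k≤n))))))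
                        (binom-beyond n (suc n) _ ≤-refl)) ⟩
      (shift u ⋆ v) n + ((u ⋆ shift v) n + 0#)
    ≈⟨ +-congˡ (+-identityʳ _) ⟩
      (shift u ⋆ v) n + (u ⋆ shift v) n
    ∎
    where
    term : ℕ → Carrier
    term k = u (suc k) * v (n ∸ k)
    head : Carrier
    head = binom R (suc n) 0 (u 0 * v (suc n))
    rest : Carrier
    rest = sumTo R n (λ k → binom R n (suc k) (term k))

  ⋆-comm : ∀ u v → u ⋆ v ≋ v ⋆ u
  ⋆-comm u v zero    = trans (⋆-at-zero u v) (trans (*-comm _ _) (sym (⋆-at-zero v u)))
  ⋆-comm u v (suc n) = begin
      (u ⋆ v) (suc n)
    ≈⟨ ⋆-suc u v n ⟩
      (shift u ⋆ v) n + (u ⋆ shift v) n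
    ≈⟨ +-cong (⋆-comm (shift u) v n) (⋆-comm u (shift v) n) ⟩
      (v ⋆ shift u) n + (shift v ⋆ u) n
    ≈⟨ +-comm _ _ ⟩
      (shift v ⋆ u) n + (v ⋆ shift u) n
    ≈⟨ sym (⋆-suc v u n) ⟩
      (v ⋆ u) (suc n)
    ∎

  ⋆-assoc : ∀ u v w → (u ⋆ v) ⋆ w ≋ u ⋆ (v ⋆ w)
  ⋆-assoc u v w zero = begin
      ((u ⋆ v) ⋆ w) 0      ≈⟨ trans (⋆-at-zero (u ⋆ v) w) (*-congʳ (⋆-at-zero u v)) ⟩
      u 0 * v 0 * w 0      ≈⟨ *-assoc _ _ _ ⟩
      u 0 * (v 0 * w 0)    ≈⟨ sym (trans (⋆-at-zero u (v ⋆ w)) (*-congˡ (⋆-at-zero v w))) ⟩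
      (u ⋆ (v ⋆ w)) 0      ∎
  ⋆-assoc u v w (suc n) = begin
      ((u ⋆ v) ⋆ w) (suc n)
    ≈⟨ ⋆-suc (u ⋆ v) w n ⟩
      (shift (u ⋆ v) ⋆ w) n + ((u ⋆ v) ⋆ shift w) n
    ≈⟨ +-congʳ (trans (⋆-congˡ w (⋆-suc u v) n) (⋆-distribʳ-+ (shift u ⋆ v) (u ⋆ shift v) w n)) ⟩
      (((shift u ⋆ v) ⋆ w) n + ((u ⋆ shift v) ⋆ w) n) + ((u ⋆ v) ⋆ shift w) n
    ≈⟨ +-cong (+-cong (⋆-assoc (shift u) v w n) (⋆-assoc u (shift v) w n)) (⋆-assoc u v (shift w) n) ⟩
      ((shift u ⋆ (v ⋆ w)) n + (u ⋆ (shift v ⋆ w)) n) + (u ⋆ (v ⋆ shift w)) n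
    ≈⟨ +-assoc _ _ _ ⟩
      (shift u ⋆ (v ⋆ w)) n + ((u ⋆ (shift v ⋆ w)) n + (u ⋆ (v ⋆ shift w)) n)
    ≈⟨ +-congˡ (trans (sym (⋆-distribˡ-+ u (shift v ⋆ w) (v ⋆ shift w) n)) (⋆-congʳ u (λ m → sym (⋆-suc v w m)) n)) ⟩
      (shift u ⋆ (v ⋆ w)) n + (u ⋆ shift (v ⋆ w)) n
    ≈⟨ sym (⋆-suc u (v ⋆ w) n) ⟩
      (u ⋆ (v ⋆ w)) (suc n)
    ∎

  ⋆-identityˡ : ∀ u → powers 0# ⋆ u ≋ u
  ⋆-identityˡ u zero    = trans (⋆-at-zero (powers 0#) u) (*-identityˡ (u 0))
  ⋆-identityˡ u (suc n) = begin
      (powers 0# ⋆ u) (suc n)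
    ≈⟨ sumTo-suc n _ ⟩
      binom R (suc n) 0 (1# * u (suc n)) + sumTo R n (λ k → binom R (suc n) (suc k) (0# * 0# ^ k * u (n ∸ k)))
    ≈⟨ +-cong (trans (binom-0 (suc n) _) (*-identityˡ _)) (sumTo-vanishing n vanishes) ⟩
      u (suc n) + 0#
    ≈⟨ +-identityʳ _ ⟩
      u (suc n)
    ∎
    where
    vanishes : ∀ k → binom R (suc n) (suc k) (0# * 0# ^ k * u (n ∸ k)) ≈ 0#
    vanishes k = trans (binom-cong (suc n) (suc k) (*-assoc _ _ _))
                       (trans (sym (binom-*ˡ (suc n) (suc k) _ _)) (zeroˡ _))

  ⋆-powers : ∀ r u v → (u ⋆ v) ⊙ powers r ≋ (u ⊙ powers r) ⋆ (v ⊙ powers r)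
  ⋆-powers r u v n = trans (*-comm _ _) (trans (*-distribˡ-sumTo n (r ^ n) _) (sumTo-cong-≤ n distribute))
    where
    distribute : ∀ k → k ≤ n → r ^ n * binom R n k (u k * v (n ∸ k))
                                ≈ binom R n k (u k * r ^ k * (v (n ∸ k) * r ^ (n ∸ k)))
    distribute k k≤n = trans (binom-*ˡ n k _ _) (binom-cong n k (begin
        r ^ n * (u k * v (n ∸ k))
      ≈⟨ *-congʳ (trans (^-congʳ r (≡.sym (m+[n∸m]≡n k≤n))) (^-homo-* r k (n ∸ k))) ⟩
        r ^ k * r ^ (n ∸ k) * (u k * v (n ∸ k))
      ≈⟨ interchange _ _ _ _ ⟩
        r ^ k * u k * (r ^ (n ∸ k) * v (n ∸ k))
      ≈⟨ *-cong (*-comm _ _) (*-comm _ _) ⟩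
        u k * r ^ k * (v (n ∸ k) * r ^ (n ∸ k))
      ∎))

  powers-+ : ∀ x y → powers (x + y) ≋ powers x ⋆ powers y
  powers-+ x y n = trans (binomialTheorem n x y) (sym (sumTo≈sum n _))

  ^-zeroˡ : ∀ n → 1# ^ n ≈ 1#
  ^-zeroˡ zero    = refl
  ^-zeroˡ (suc n) = trans (*-identityˡ _) (^-zeroˡ n)

  powers-1#-⊙ : ∀ u → powers 1# ⊙ u ≋ u
  powers-1#-⊙ u m = trans (*-congʳ (^-zeroˡ m)) (*-identityˡ (u m))

  sgn-square : ∀ n → sgn R n * sgn R n ≈ 1#
  sgn-square n = begin
      (- 1#) ^ n * (- 1#) ^ n  ≈⟨ sym (^-distrib-* (- 1#) (- 1#) n) ⟩
      (- 1# * - 1#) ^ n        ≈⟨ ^-congˡ n (trans (-1*x≈-x (- 1#)) (-‿involutive 1#)) ⟩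
      1# ^ n                   ≈⟨ ^-zeroˡ n ⟩
      1#                       ∎

  sgn⋆ones : powers (- 1#) ⋆ powers 1# ≋ powers 0#
  sgn⋆ones n = trans (sym (powers-+ (- 1#) 1# n)) (^-congˡ n (-‿inverseˡ 1#))

  Mbar-as-⋆ : ∀ a → Mbar R a ≋ (a ⊙ powers (- 1#)) ⋆ powers 1#
  Mbar-as-⋆ a j = sumTo-cong j (λ l → trans (binom-*ˡ j l _ _) (binom-cong j l (begin
      sgn R l * a l               ≈⟨ *-comm _ _ ⟩
      a l * sgn R l               ≈⟨ sym (*-identityʳ _) ⟩
      a l * sgn R l * 1#          ≈⟨ *-congˡ (sym (^-zeroˡ (j ∸ l))) ⟩
      a l * sgn R l * 1# ^ (j ∸ l) ∎)))

  Mbar-involutive : ∀ a → Mbar R (Mbar R a) ≋ a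
  Mbar-involutive a n = begin
      Mbar R (Mbar R a) n
    ≈⟨ Mbar-as-⋆ (Mbar R a) n ⟩
      ((Mbar R a ⊙ σ) ⋆ ι) n
    ≈⟨ ⋆-congˡ ι (λ m → *-congʳ (Mbar-as-⋆ a m)) n ⟩
      ((((a ⊙ σ) ⋆ ι) ⊙ σ) ⋆ ι) n
    ≈⟨ ⋆-congˡ ι (⋆-powers (- 1#) (a ⊙ σ) ι) n ⟩
      (((a ⊙ σ ⊙ σ) ⋆ (ι ⊙ σ)) ⋆ ι) n
    ≈⟨ ⋆-congˡ ι (⋆-cong sgn-cancels (powers-1#-⊙ σ)) n ⟩
      ((a ⋆ σ) ⋆ ι) n
    ≈⟨ ⋆-assoc a σ ι n ⟩
      (a ⋆ (σ ⋆ ι)) n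
    ≈⟨ ⋆-congʳ a sgn⋆ones n ⟩
      (a ⋆ powers 0#) n
    ≈⟨ ⋆-comm a (powers 0#) n ⟩
      (powers 0# ⋆ a) n
    ≈⟨ ⋆-identityˡ a n ⟩
      a n
    ∎
    where
    σ ι : Seq
    σ = powers (- 1#)
    ι = powers 1#
    sgn-cancels : a ⊙ σ ⊙ σ ≋ a
    sgn-cancels m = trans (*-assoc _ _ _) (trans (*-congˡ (sgn-square m)) (*-identityʳ (a m)))

  Mbar-deconvolution : ∀ x b → (Mbar R b ⊙ powers (- 1#) ⊙ powers x) ⋆ powers x ≋ b ⊙ powers x
  Mbar-deconvolution x b n = begin
      ((Mbar R b ⊙ σ ⊙ X) ⋆ X) n
    ≈⟨ ⋆-congʳ (Mbar R b ⊙ σ ⊙ X) {v′ = powers 1# ⊙ X} (λ m → sym (powers-1#-⊙ X m)) n ⟩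
      ((Mbar R b ⊙ σ ⊙ X) ⋆ (powers 1# ⊙ X)) n
    ≈⟨ sym (⋆-powers x (Mbar R b ⊙ σ) (powers 1#) n) ⟩
      ((Mbar R b ⊙ σ) ⋆ powers 1#) n * x ^ n
    ≈⟨ *-congʳ (sym (Mbar-as-⋆ (Mbar R b) n)) ⟩
      Mbar R (Mbar R b) n * x ^ n
    ≈⟨ *-congʳ (Mbar-involutive b n) ⟩
      b n * x ^ n
    ∎
    where
    σ X : Seq
    σ = powers (- 1#)
    X = powers x

  appell-+ : ∀ cs x y → cs ⋆ powers (x + y) ≋ powers x ⋆ (cs ⋆ powers y)
  appell-+ cs x y m = begin
      (cs ⋆ powers (x + y)) m        ≈⟨ ⋆-congʳ cs (powers-+ x y) m ⟩
      (cs ⋆ (powers x ⋆ powers y)) m ≈⟨ sym (⋆-assoc cs (powers x) (powers y) m) ⟩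
      ((cs ⋆ powers x) ⋆ powers y) m ≈⟨ ⋆-congˡ (powers y) (⋆-comm cs (powers x)) m ⟩
      ((powers x ⋆ cs) ⋆ powers y) m ≈⟨ ⋆-assoc (powers x) cs (powers y) m ⟩
      (powers x ⋆ (cs ⋆ powers y)) m ∎

  Mbar-appell-sum : ∀ cs b n x y →
    sumTo R n (λ j → sgn R j * binom R n j (Mbar R b j) * appell R cs (n ∸ j) (x + y) * x ^ j)
    ≈ ((b ⊙ powers x) ⋆ (cs ⋆ powers y)) n
  Mbar-appell-sum cs b n x y = begin
      sumTo R n (λ j → sgn R j * binom R n j (Mbar R b j) * appell R cs (n ∸ j) (x + y) * x ^ j)
    ≈⟨ sumTo-cong n regroup ⟩
      (D ⋆ (cs ⋆ powers (x + y))) n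
    ≈⟨ ⋆-congʳ D (appell-+ cs x y) n ⟩
      (D ⋆ (powers x ⋆ (cs ⋆ powers y))) n
    ≈⟨ sym (⋆-assoc D (powers x) (cs ⋆ powers y) n) ⟩
      ((D ⋆ powers x) ⋆ (cs ⋆ powers y)) n
    ≈⟨ ⋆-congˡ (cs ⋆ powers y) (Mbar-deconvolution x b) n ⟩
      ((b ⊙ powers x) ⋆ (cs ⋆ powers y)) n
    ∎
    where
    D : Seq
    D = Mbar R b ⊙ powers (- 1#) ⊙ powers x
    regroup : ∀ j → sgn R j * binom R n j (Mbar R b j) * appell R cs (n ∸ j) (x + y) * x ^ j
                    ≈ binom R n j (D j * appell R cs (n ∸ j) (x + y))
    regroup j = begin
        sgn R j * binom R n j (Mbar R b j) * f * x ^ j   ≈⟨ *-congʳ (binom-float n j _ _ _) ⟩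
        binom R n j (sgn R j * Mbar R b j * f) * x ^ j   ≈⟨ binom-*ʳ n j _ _ ⟩
        binom R n j (sgn R j * Mbar R b j * f * x ^ j)   ≈⟨ binom-cong n j (xy∙z≈xz∙y _ _ _) ⟩
        binom R n j (sgn R j * Mbar R b j * x ^ j * f)   ≈⟨ binom-cong n j (*-congʳ (*-congʳ (*-comm _ _))) ⟩
        binom R n j (D j * f)                            ∎
      where
      f : Carrier
      f = appell R cs (n ∸ j) (x + y)

  identity₂ : ∀ cs as n x y → Identity₂ R cs as n x y
  identity₂ cs as n x y = begin
      sumTo R n (λ k → as k * binom R n k (appell R cs (n ∸ k) y) * x ^ k)
    ≈⟨ sumTo-cong n (λ k → trans (binom-float n k _ _ _) (binom-cong n k (xy∙z≈xz∙y _ _ _))) ⟩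
      ((as ⊙ powers x) ⋆ (cs ⋆ powers y)) n
    ≈⟨ sym (Mbar-appell-sum cs as n x y) ⟩
      sumTo R n (λ j → sgn R j * binom R n j (Mbar R as j) * appell R cs (n ∸ j) (x + y) * x ^ j)
    ∎

  identity₁ : ∀ cs as n x y → Identity₁ R cs as n x y
  identity₁ cs as n x y = begin
      sumTo R n (λ k → as k * binom R n k (appell R cs k y) * x ^ (n ∸ k))
    ≈⟨ sumTo-cong n (λ k → binom-float n k _ _ _) ⟩
      ((as ⊙ (cs ⋆ powers y)) ⋆ powers x) n
    ≈⟨ ⋆-comm (as ⊙ (cs ⋆ powers y)) (powers x) n ⟩
      (powers x ⋆ (as ⊙ (cs ⋆ powers y))) n
    ≈⟨ sumTo-cong n (λ k → binom-cong n k (x∙yz≈yx∙z _ _ _)) ⟩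
      ((reversed ⊙ powers x) ⋆ (cs ⋆ powers y)) n
    ≈⟨ sym (Mbar-appell-sum cs reversed n x y) ⟩
      sumTo R n (λ j → sgn R j * binom R n j (M R as n j) * appell R cs (n ∸ j) (x + y) * x ^ j)
    ∎
    where
    reversed : Seq
    reversed l = as (n ∸ l)

open CommutativeRing using (Carrier; _≈_; 1#; _+_)

mainTheorem12 : ∀ {c ℓ} (R : CommutativeRing c ℓ) (cs as : ℕ → Carrier R) →
    _≈_ R (cs 0) (1# R) →
    ∀ (n : ℕ) (x y : Carrier R) →
    Identity₁ R cs as n x y × Identity₂ R cs as n x y
mainTheorem12 R cs as _ n x y = identity₁ cs as n x y , identity₂ cs as n x y
  where open BinomialConvolution R
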